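{- Let $\alpha<\beta<\gamma$ be distinct primes, let $G=\langle a\rangle$ be a cyclic group of order $\alpha^2\beta^2\gamma^2$, and let $C=\{x\in G : |x|\in\{\alpha^2,\beta^2,\gamma^2\}\}$. Let $Cay_{p^2}(G,C)$ be the simple undirected graph with vertex set $G$ in which two distinct vertices $x,y$ are adjacent if and only if $xy^{ -1}\in C$. Then $Cay_{p^2}(G,C)$ is connected.
   Context: $|x|$ denotes the order of the element $x$ in $G$. -}

module Defs where

open import Level using (_⊔_)
open import Algebra.Bundles using (Group)
open import Data.Nat using (ℕ; zero; suc; _*_; _<_)
open import Data.Product using (Σ; _×_; ∃)
open import Data.Sum using (_⊎_)
open import Relation.Nullary using (¬_)

module _ {c ℓ} (G : Group c ℓ) where
  open Group G

  pow : Carrier → ℕ → Carrier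
  pow x zero    = ε
  pow x (suc k) = x ∙ pow x k

  HasOrder : Carrier → ℕ → Set ℓ
  HasOrder x k = (0 < k) × (pow x k ≈ ε) × (∀ j → 0 < j → j < k → ¬ (pow x j ≈ ε))

  CyclicOfOrder : Carrier → ℕ → Set (c ⊔ ℓ)
  CyclicOfOrder a n = HasOrder a n × (∀ x → ∃ λ k → x ≈ pow a k)

  InC : ℕ → ℕ → ℕ → Carrier → Set ℓ
  InC α β γ x = HasOrder x (α * α) ⊎ HasOrder x (β * β) ⊎ HasOrder x (γ * γ)

  Adj : ℕ → ℕ → ℕ → Carrier → Carrier → Set ℓ
  Adj α β γ x y = ¬ (x ≈ y) × InC α β γ (x ∙ y ⁻¹)

  data Walk (α β γ : ℕ) : Carrier → Carrier → Set (c ⊔ ℓ) where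
    here : ∀ {x y} → x ≈ y → Walk α β γ x y
    step : ∀ {x y z} → Adj α β γ x z → Walk α β γ z y → Walk α β γ x y

  Connected : ℕ → ℕ → ℕ → Set (c ⊔ ℓ)
  Connected α β γ = ∀ x y → Walk α β γ x y

{-# OPTIONS --safe #-}
-- Call t reachable if every vertex x is joined to t ∙ x by a walk. The reachable
-- elements form a subgroup (closed under inverses because the graph is undirected)
-- containing C, since s ∙ x is adjacent to x for s ∈ C. With |a| = A B C, where
-- A = α², B = β², C = γ², the powers a^(BC), a^(AC), a^(AB) have orders A, B, C and
-- so lie in C. As A, B, C are pairwise coprime, gcd(AB, AC) = A and gcd(A, BC) = 1,
-- so by Bézout the subgroup contains a, hence all of G.
module Submission where

open import Defs
open import Algebra.Bundles using (Group)
open import Data.Nat using (ℕ; _*_; _<_)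
open import Data.Nat.Primality using (Prime)

open import Level using (_⊔_)
open import Data.Nat using (zero; suc; _+_; NonZero; >-nonZero; >-nonZero⁻¹; nonTrivial⇒n>1; s≤s; z≤n)
open import Data.Nat.Properties
  using (+-comm; *-identityʳ; *-assoc; *-mono-<; *-monoˡ-<; m*n≢0⇒m≢0; m*n≢0⇒n≢0; <-trans; *-commutativeSemigroup)
open import Data.Nat.Primality using (prime⇒nonZero; prime⇒nonTrivial)
open import Data.Nat.Divisibility using (∣-trans)
open import Data.Nat.Coprimality as Coprime using (Coprime; coprime-divisor; coprime⇒gcd≡1; prime⇒coprime)
open import Data.Nat.GCD using (gcd; gcd-GCD; c*gcd[m,n]≡gcd[cm,cn]; module Bézout)
open import Algebra.Properties.CommutativeSemigroup *-commutativeSemigroup using (xy∙z≈y∙xz; xy∙z≈z∙xy)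
open import Data.Product using (_,_; ∃)
open import Data.Sum using (inj₁; inj₂; [_,_]) renaming (map to ⊎-map)
open import Function using (_∘_)
open import Relation.Nullary using (¬_)
open import Relation.Unary using (Pred)
open import Relation.Binary.Definitions using (_Respects_)
open import Relation.Binary.PropositionalEquality as ≡ using (_≡_)

coprime-*ʳ : ∀ {m n o} → Coprime m n → Coprime m o → Coprime m (n * o)
coprime-*ʳ {n = n} m⊥n m⊥o {i} (i∣m , i∣n*o) = m⊥o (i∣m , coprime-divisor i⊥n i∣n*o)
  where
  i⊥n : Coprime i n
  i⊥n (d∣i , d∣n) = m⊥n (∣-trans d∣i i∣m , d∣n)

coprime-*ˡ : ∀ {m n o} → Coprime m o → Coprime n o → Coprime (m * n) o
coprime-*ˡ m⊥o n⊥o = Coprime.sym (coprime-*ʳ (Coprime.sym m⊥o) (Coprime.sym n⊥o))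

coprime-prime-squares : ∀ {p q} → Prime p → Prime q → p < q → Coprime (p * p) (q * q)
coprime-prime-squares {p} {q} pp pq p<q = coprime-*ˡ (coprime-*ʳ p⊥q p⊥q) (coprime-*ʳ p⊥q p⊥q)
  where
  p⊥q : Coprime p q
  p⊥q = Coprime.sym (prime⇒coprime pq {{prime⇒nonZero pp}} p<q)

gcd[cm,cn]≡c : ∀ c {m n} → Coprime m n → gcd (c * m) (c * n) ≡ c
gcd[cm,cn]≡c c {m} {n} m⊥n = begin
  gcd (c * m) (c * n)  ≡⟨ c*gcd[m,n]≡gcd[cm,cn] c m n ⟨
  c * gcd m n          ≡⟨ ≡.cong (c *_) (coprime⇒gcd≡1 m⊥n) ⟩
  c * 1                ≡⟨ *-identityʳ c ⟩
  c                    ∎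
  where open ≡.≡-Reasoning

prime⇒1< : ∀ {p} → Prime p → 1 < p
prime⇒1< {p} pp = nonTrivial⇒n>1 p {{prime⇒nonTrivial pp}}

module GroupPowers {c ℓ} (G : Group c ℓ) where
  open Group G
  open import Algebra.Properties.Group G
  open import Algebra.Properties.Monoid.Mult monoid using (_×_; ×-congʳ; ×-homo-+; ×-assocˡ)
  open import Relation.Binary.Reasoning.Setoid setoid

  pow≡× : ∀ x k → pow G x k ≡ k × x
  pow≡× x zero    = ≡.refl
  pow≡× x (suc k) = ≡.cong (x ∙_) (pow≡× x k)

  pow-cong : ∀ {x y} k → x ≈ y → pow G x k ≈ pow G y k
  pow-cong {x} {y} k x≈y = begin
    pow G x k  ≡⟨ pow≡× x k ⟩
    k × x      ≈⟨ ×-congʳ k x≈y ⟩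
    k × y      ≡⟨ pow≡× y k ⟨
    pow G y k  ∎

  pow-+ : ∀ x m n → pow G x (m + n) ≈ pow G x m ∙ pow G x n
  pow-+ x m n = begin
    pow G x (m + n)          ≡⟨ pow≡× x (m + n) ⟩
    (m + n) × x              ≈⟨ ×-homo-+ x m n ⟩
    m × x ∙ n × x            ≡⟨ ≡.cong₂ _∙_ (pow≡× x m) (pow≡× x n) ⟨
    pow G x m ∙ pow G x n    ∎

  pow-* : ∀ x m n → pow G (pow G x m) n ≈ pow G x (n * m)
  pow-* x m n = begin
    pow G (pow G x m) n  ≡⟨ pow≡× (pow G x m) n ⟩
    n × pow G x m        ≡⟨ ≡.cong (n ×_) (pow≡× x m) ⟩
    n × (m × x)          ≈⟨ ×-assocˡ x n m ⟩
    (n * m) × x          ≡⟨ pow≡× x (n * m) ⟨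
    pow G x (n * m)      ∎

  pow-comm : ∀ x k → pow G x k ∙ x ≈ x ∙ pow G x k
  pow-comm x k = begin
    pow G x k ∙ x          ≈⟨ ∙-congˡ (identityʳ x) ⟨
    pow G x k ∙ pow G x 1  ≈⟨ pow-+ x k 1 ⟨
    pow G x (k + 1)        ≡⟨ ≡.cong (pow G x) (+-comm k 1) ⟩
    x ∙ pow G x k          ∎

  pow-⁻¹ : ∀ x k → pow G (x ⁻¹) k ≈ pow G x k ⁻¹
  pow-⁻¹ x zero    = sym ε⁻¹≈ε
  pow-⁻¹ x (suc k) = begin
    x ⁻¹ ∙ pow G (x ⁻¹) k    ≈⟨ ∙-congˡ (pow-⁻¹ x k) ⟩
    x ⁻¹ ∙ pow G x k ⁻¹      ≈⟨ ⁻¹-anti-homo-∙ (pow G x k) x ⟨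
    (pow G x k ∙ x) ⁻¹       ≈⟨ ⁻¹-cong (pow-comm x k) ⟩
    (x ∙ pow G x k) ⁻¹       ∎

  HasOrder-resp : ∀ {k} → (λ x → HasOrder G x k) Respects _≈_
  HasOrder-resp {k} x≈y (0<k , xᵏ≈ε , minimal) =
    0<k , trans (pow-cong k (sym x≈y)) xᵏ≈ε ,
    λ j 0<j j<k yʲ≈ε → minimal j 0<j j<k (trans (pow-cong j x≈y) yʲ≈ε)

  HasOrder-⁻¹ : ∀ {x k} → HasOrder G x k → HasOrder G (x ⁻¹) k
  HasOrder-⁻¹ {x} {k} (0<k , xᵏ≈ε , minimal) =
    0<k , trans (pow-⁻¹ x k) (trans (⁻¹-cong xᵏ≈ε) ε⁻¹≈ε) ,
    λ j 0<j j<k x⁻ʲ≈ε → minimal j 0<j j<k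
      (⁻¹-injective (trans (sym (pow-⁻¹ x j)) (trans x⁻ʲ≈ε (sym ε⁻¹≈ε))))

  HasOrder-pow : ∀ {x} k e → HasOrder G x (k * e) → HasOrder G (pow G x e) k
  HasOrder-pow {x} k e (0<k*e , xᵏᵉ≈ε , minimal) =
    0<k , trans (pow-* x e k) xᵏᵉ≈ε ,
    λ j 0<j j<k xᵉʲ≈ε → minimal (j * e) (*-mono-< 0<j 0<e) (*-monoˡ-< e j<k)
                          (trans (sym (pow-* x e j)) xᵉʲ≈ε)
    where
    instance
      k*e≢0 : NonZero (k * e)
      k*e≢0 = >-nonZero 0<k*e
      e≢0 : NonZero e
      e≢0 = m*n≢0⇒n≢0 k
    0<k : 0 < k
    0<k = >-nonZero⁻¹ k {{m*n≢0⇒m≢0 k}}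
    0<e : 0 < e
    0<e = >-nonZero⁻¹ e

  HasOrder⇒≉ε : ∀ {x k} → HasOrder G x k → 1 < k → ¬ x ≈ ε
  HasOrder⇒≉ε {x} (_ , _ , minimal) 1<k x≈ε = minimal 1 (s≤s z≤n) 1<k (trans (identityʳ x) x≈ε)

module Subgroups {c ℓ} (G : Group c ℓ) where
  open Group G
  open import Algebra.Properties.Group G
  open import Relation.Binary.Reasoning.Setoid setoid
  open GroupPowers G

  record IsSubgroup {p} (H : Pred Carrier p) : Set (c ⊔ ℓ ⊔ p) where
    field
      ∈-resp-≈  : H Respects _≈_
      ε-closed  : H ε
      ∙-closed  : ∀ {x y} → H x → H y → H (x ∙ y)
      ⁻¹-closed : ∀ {x} → H x → H (x ⁻¹)

  module _ {p} {H : Pred Carrier p} (H-subgroup : IsSubgroup H) where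
    open IsSubgroup H-subgroup

    pow-closed : ∀ {x} k → H x → H (pow G x k)
    pow-closed zero    _  = ε-closed
    pow-closed (suc k) hx = ∙-closed hx (pow-closed k hx)

    pow-multiple-closed : ∀ {a} m k → H (pow G a m) → H (pow G a (k * m))
    pow-multiple-closed {a} m k h = ∈-resp-≈ (pow-* a m k) (pow-closed k h)

    pow-difference-closed : ∀ {a} d e f → d + e ≡ f → H (pow G a f) → H (pow G a e) → H (pow G a d)
    pow-difference-closed {a} d e f d+e≡f hf he = ∈-resp-≈ aᶠ//aᵉ≈aᵈ (∙-closed hf (⁻¹-closed he))
      where
      aᶠ//aᵉ≈aᵈ : pow G a f // pow G a e ≈ pow G a d
      aᶠ//aᵉ≈aᵈ = begin
        pow G a f // pow G a e                ≡⟨ ≡.cong (λ i → pow G a i // pow G a e) d+e≡f ⟨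
        pow G a (d + e) // pow G a e          ≈⟨ //-cong₂ (pow-+ a d e) refl ⟩
        (pow G a d ∙ pow G a e) // pow G a e  ≈⟨ //-rightDividesʳ (pow G a e) (pow G a d) ⟩
        pow G a d                             ∎

    pow-gcd-closed : ∀ {a} m n → H (pow G a m) → H (pow G a n) → H (pow G a (gcd m n))
    pow-gcd-closed m n hm hn with Bézout.identity (gcd-GCD m n)
    ... | Bézout.+- x y eq = pow-difference-closed _ (y * n) (x * m) eq
                               (pow-multiple-closed m x hm) (pow-multiple-closed n y hn)
    ... | Bézout.-+ x y eq = pow-difference-closed _ (x * m) (y * n) eq
                               (pow-multiple-closed n y hn) (pow-multiple-closed m x hm)

    cofactor-powers-generate : ∀ {a A B C} → Coprime A B → Coprime A C → Coprime B C →
      H (pow G a (B * C)) → H (pow G a (A * C)) → H (pow G a (A * B)) → H a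
    cofactor-powers-generate {a} {A} {B} {C} A⊥B A⊥C B⊥C h-BC h-AC h-AB =
      ∈-resp-≈ (identityʳ a)
        (subst-pow (coprime⇒gcd≡1 (coprime-*ʳ A⊥B A⊥C)) (pow-gcd-closed A (B * C) h-A h-BC))
      where
      subst-pow : ∀ {m n} → m ≡ n → H (pow G a m) → H (pow G a n)
      subst-pow = ≡.subst (H ∘ pow G a)
      h-A : H (pow G a A)
      h-A = subst-pow (gcd[cm,cn]≡c A B⊥C) (pow-gcd-closed (A * B) (A * C) h-AB h-AC)

    generator-closed⇒all : ∀ {a} → H a → (∀ x → ∃ λ k → x ≈ pow G a k) → ∀ x → H x
    generator-closed⇒all ha generates x with generates x
    ... | k , x≈aᵏ = ∈-resp-≈ (sym x≈aᵏ) (pow-closed k ha)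

module CayleyWalks {c ℓ} (G : Group c ℓ) (α β γ : ℕ) where
  open Group G
  open import Algebra.Properties.Group G
  open GroupPowers G
  open Subgroups G using (IsSubgroup)

  InC-resp-≈ : InC G α β γ Respects _≈_
  InC-resp-≈ x≈y = ⊎-map (HasOrder-resp x≈y) (⊎-map (HasOrder-resp x≈y) (HasOrder-resp x≈y))

  InC-⁻¹ : ∀ {x} → InC G α β γ x → InC G α β γ (x ⁻¹)
  InC-⁻¹ = ⊎-map HasOrder-⁻¹ (⊎-map HasOrder-⁻¹ HasOrder-⁻¹)

  InC⇒≉ε : 1 < α → 1 < β → 1 < γ → ∀ {x} → InC G α β γ x → ¬ x ≈ ε
  InC⇒≉ε 1<α 1<β 1<γ =
    [ (λ o → HasOrder⇒≉ε o (*-mono-< 1<α 1<α))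
    , [ (λ o → HasOrder⇒≉ε o (*-mono-< 1<β 1<β))
      , (λ o → HasOrder⇒≉ε o (*-mono-< 1<γ 1<γ)) ] ]

  Adj-sym : ∀ {x y} → Adj G α β γ x y → Adj G α β γ y x
  Adj-sym {x} {y} (x≉y , x//y∈C) = x≉y ∘ sym , InC-resp-≈ (⁻¹-anti-homo-// x y) (InC-⁻¹ x//y∈C)

  Adj-respˡ : ∀ {x x′ y} → x ≈ x′ → Adj G α β γ x y → Adj G α β γ x′ y
  Adj-respˡ x≈x′ (x≉y , x//y∈C) = x≉y ∘ trans x≈x′ , InC-resp-≈ (∙-congʳ x≈x′) x//y∈C

  Walk-respˡ : ∀ {x x′ y} → x ≈ x′ → Walk G α β γ x y → Walk G α β γ x′ y
  Walk-respˡ x≈x′ (here x≈y)   = here (trans (sym x≈x′) x≈y)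
  Walk-respˡ x≈x′ (step adj w) = step (Adj-respˡ x≈x′ adj) w

  Walk-respʳ : ∀ {x y y′} → y ≈ y′ → Walk G α β γ x y → Walk G α β γ x y′
  Walk-respʳ y≈y′ (here x≈y)   = here (trans x≈y y≈y′)
  Walk-respʳ y≈y′ (step adj w) = step adj (Walk-respʳ y≈y′ w)

  Walk-++ : ∀ {x y z} → Walk G α β γ x y → Walk G α β γ y z → Walk G α β γ x z
  Walk-++ (here x≈y)   w′ = Walk-respˡ (sym x≈y) w′
  Walk-++ (step adj w) w′ = step adj (Walk-++ w w′)

  Walk-reverse : ∀ {x y} → Walk G α β γ x y → Walk G α β γ y x
  Walk-reverse (here x≈y)   = here (sym x≈y)
  Walk-reverse (step adj w) = Walk-++ (Walk-reverse w) (step (Adj-sym adj) (here refl))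

  Reachable : Pred Carrier (c ⊔ ℓ)
  Reachable t = ∀ x → Walk G α β γ x (t ∙ x)

  Reachable-isSubgroup : IsSubgroup Reachable
  Reachable-isSubgroup = record
    { ∈-resp-≈  = λ s≈t reach-s x → Walk-respʳ (∙-congʳ s≈t) (reach-s x)
    ; ε-closed  = λ x → here (sym (identityˡ x))
    ; ∙-closed  = λ {s} {t} reach-s reach-t x →
        Walk-respʳ (sym (assoc s t x)) (Walk-++ (reach-t x) (reach-s (t ∙ x)))
    ; ⁻¹-closed = λ {t} reach-t x →
        Walk-respˡ (\\-leftDividesˡ t x) (Walk-reverse (reach-t (t ⁻¹ ∙ x)))
    }

  InC⇒Reachable : 1 < α → 1 < β → 1 < γ → ∀ {s} → InC G α β γ s → Reachable s
  InC⇒Reachable 1<α 1<β 1<γ {s} s∈C x = step (Adj-sym sx-adj-x) (here refl)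
    where
    sx-adj-x : Adj G α β γ (s ∙ x) x
    sx-adj-x = (InC⇒≉ε 1<α 1<β 1<γ s∈C ∘ identityˡ-unique s x)
             , InC-resp-≈ (sym (//-rightDividesʳ x s)) s∈C

  all-Reachable⇒Connected : (∀ t → Reachable t) → Connected G α β γ
  all-Reachable⇒Connected reach x y = Walk-respʳ (//-rightDividesˡ x y) (reach (y // x) x)

proposition2p5 : ∀ {c ℓ} (G : Group c ℓ) (α β γ : ℕ) → Prime α → Prime β → Prime γ →
                   α < β → β < γ → (a : Group.Carrier G) →
                   CyclicOfOrder G a ((α * α) * (β * β) * (γ * γ)) →
                   Connected G α β γ
proposition2p5 G α β γ pα pβ pγ α<β β<γ a (a-order , a-generates) =
  all-Reachable⇒Connected (generator-closed⇒all Reachable-isSubgroup reach-a a-generates)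
  where
  open GroupPowers G
  open Subgroups G
  open CayleyWalks G α β γ
  A B C : ℕ
  A = α * α
  B = β * β
  C = γ * γ

  cofactor-order : ∀ k e → (A * B) * C ≡ k * e → HasOrder G (pow G a e) k
  cofactor-order k e n≡k*e = HasOrder-pow k e (≡.subst (HasOrder G a) n≡k*e a-order)

  reachable : ∀ {s} → InC G α β γ s → Reachable s
  reachable = InC⇒Reachable (prime⇒1< pα) (prime⇒1< pβ) (prime⇒1< pγ)

  reach-a : Reachable a
  reach-a = cofactor-powers-generate Reachable-isSubgroup
    (coprime-prime-squares pα pβ α<β) (coprime-prime-squares pα pγ (<-trans α<β β<γ))
    (coprime-prime-squares pβ pγ β<γ)
    (reachable (inj₁ (cofactor-order A (B * C) (*-assoc A B C))))
    (reachable (inj₂ (inj₁ (cofactor-order B (A * C) (xy∙z≈y∙xz A B C)))))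
    (reachable (inj₂ (inj₂ (cofactor-order C (A * B) (xy∙z≈z∙xy A B C)))))
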